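{- The number of linear $2\times$MDS codes in $D(m,n)$ is $2\cdot 3^{m+n}$.
   Context: The Shrikhande graph $\mathrm{Sh}$ is the Cayley graph of $\mathbb{Z}_4^2$ with connecting set $\{(0,1),(1,0),(1,1),(0,3),(3,0),(3,3)\}$. $K=K_4$ is the complete graph on $4$ vertices (Cayley graph of $\mathbb{Z}_2^2$ with connecting set $\{(0,1),(1,0),(1,1)\}$). $D(m,n)=\mathrm{Sh}^m\times K^n$ is the Cartesian product: vertices are tuples $(x_1,\dots,x_m,y_1,\dots,y_n)$, $x_i\in\mathbb{Z}_4^2$, $y_j\in\mathbb{Z}_2^2$, adjacent iff they differ in exactly one coordinate and the differing entries are adjacent in the corresponding factor. A $2\times$MDS code of $\mathrm{Sh}$ is a set of $8$ vertices of $\mathrm{Sh}$ that is the union of two disjoint independent $4$-sets. A $2\times$MDS code $M$ in $D(m,n)$ is linear if there exist subsets $A_1,\dots,A_m\subset\mathbb{Z}_4^2$, each a $2\times$MDS code of $\mathrm{Sh}$ whose induced subgraph in $\mathrm{Sh}$ is disconnected, subsets $B_1,\dots,B_n\subset\mathbb{Z}_2^2$ of size $2$, and $\sigma\in\{0,1\}$, such that $\chi_M(x_1,\dots,x_m,y_1,\dots,y_n)\equiv\sum_i\chi_{A_i}(x_i)+\sum_j\chi_{B_j}(y_j)+\sigma\pmod 2$ ($\chi$ denotes characteristic functions). -}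

module Defs where

open import Data.Nat using (ℕ; zero; suc; _+_; _∸_)
open import Data.Nat.DivMod using (_mod_)
open import Data.Fin using (Fin; zero; suc; toℕ; #_)
open import Data.Bool using (Bool; true; false; _xor_; _∨_; _∧_)
open import Data.Product using (Σ; _×_; _,_)
open import Relation.Binary.PropositionalEquality using (_≡_)
open import Relation.Nullary using (¬_)

Z4 : Set
Z4 = Fin 4

Z4² : Set
Z4² = Z4 × Z4

Z2² : Set
Z2² = Fin 2 × Fin 2

sub4 : Z4 → Z4 → Z4
sub4 a b = (toℕ a + 4 ∸ toℕ b) mod 4

sub : Z4² → Z4² → Z4²
sub (a₁ , a₂) (b₁ , b₂) = sub4 a₁ b₁ , sub4 a₂ b₂

-- connecting set of the Shrikhande graph
data ShConn : Z4² → Set where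
  c01 : ShConn (# 0 , # 1)
  c10 : ShConn (# 1 , # 0)
  c11 : ShConn (# 1 , # 1)
  c03 : ShConn (# 0 , # 3)
  c30 : ShConn (# 3 , # 0)
  c33 : ShConn (# 3 , # 3)

ShAdj : Z4² → Z4² → Set
ShAdj u v = ShConn (sub u v)

Subset4 : Set
Subset4 = Z4² → Bool

Subset2 : Set
Subset2 = Z2² → Bool

sumFin : ∀ k → (Fin k → ℕ) → ℕ
sumFin zero    f = 0
sumFin (suc k) f = f zero + sumFin k (λ i → f (suc i))

b2n : Bool → ℕ
b2n true  = 1
b2n false = 0

card4 : Subset4 → ℕ
card4 A = sumFin 4 (λ i → sumFin 4 (λ j → b2n (A (i , j))))

card2 : Subset2 → ℕ
card2 B = sumFin 2 (λ i → sumFin 2 (λ j → b2n (B (i , j))))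

Independent : Subset4 → Set
Independent I = ∀ u v → I u ≡ true → I v ≡ true → ¬ ShAdj u v

Is2MDS : Subset4 → Set
Is2MDS A =
  card4 A ≡ 8 ×
  Σ Subset4 λ I → Σ Subset4 λ J →
    Independent I × Independent J × card4 I ≡ 4 × card4 J ≡ 4 ×
    (∀ u → I u ∧ J u ≡ false) ×
    (∀ u → A u ≡ I u ∨ J u)

-- reachability inside the subgraph of Sh induced by A
-- (walk from u to w all of whose vertices after u lie in A)
data Reach (A : Subset4) : Z4² → Z4² → Set where
  here : ∀ {u} → Reach A u u
  step : ∀ {u v w} → A v ≡ true → ShAdj u v → Reach A v w → Reach A u w

Disconnected : Subset4 → Set
Disconnected A =
  Σ Z4² λ u → Σ Z4² λ v → A u ≡ true × A v ≡ true × ¬ Reach A u v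

xorSum : ∀ k → (Fin k → Bool) → Bool
xorSum zero    f = false
xorSum (suc k) f = f zero xor xorSum k (λ i → f (suc i))

-- vertices of D(m,n) = Sh^m × K^n
Vertex : ℕ → ℕ → Set
Vertex m n = (Fin m → Z4²) × (Fin n → Z2²)

Code : ℕ → ℕ → Set
Code m n = Vertex m n → Bool

Linear : ∀ m n → Code m n → Set
Linear m n M =
  Σ (Fin m → Subset4) λ A →
  Σ (Fin n → Subset2) λ B →
  Σ Bool λ σ →
    (∀ i → Is2MDS (A i) × Disconnected (A i)) ×
    (∀ j → card2 (B j) ≡ 2) ×
    (∀ x y → M (x , y) ≡
       (xorSum m (λ i → A i (x i)) xor xorSum n (λ j → B j (y j))) xor σ)

_≐_ : ∀ {m n} → Code m n → Code m n → Set
M ≐ M' = ∀ v → M v ≡ M' v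

-- A disconnected 2×MDS code of Sh, and likewise a 2-subset of K, is one of the six
-- sets {u | χ u = s} with χ one of the three nonzero homomorphisms onto ℤ₂ and
-- s ∈ ℤ₂. For Sh this is a finite check: the 16 independent 4-sets are enumerated,
-- and among the unions of two disjoint ones only these six are disconnected.
-- Substituting into the defining sum, the constants s are absorbed into σ, so a
-- linear code is determined by σ and one homomorphism per coordinate. Conversely
-- every such choice gives a linear code, and evaluating the code at the origin and
-- at the unit vectors recovers the choice. Hence the linear codes correspond to
-- {0,1} × {1,2,3}^(m+n).
module Submission where

open import Defs
open import Data.Nat using (ℕ; _*_; _^_; _+_)
open import Data.Fin using (Fin)
open import Data.Product using (Σ; _×_; _,_)
open import Relation.Binary.PropositionalEquality using (_≡_)

open import Algebra.Bundles using (CommutativeRing)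
open import Algebra.Properties.CommutativeSemigroup using (interchange)
open import Data.Bool using (Bool; true; false; _∨_; _∧_; _xor_; not)
import Data.Bool.Properties as Bool
open import Data.Empty using (⊥-elim)
open import Data.Fin
  using (zero; suc; toℕ; punchIn; _↑ˡ_; _↑ʳ_; splitAt; combine; remQuot; funToFin; finToFun)
open import Data.Fin.Patterns using (0F; 1F; 2F; 3F)
open import Data.Fin.Properties
  using ( all?; any?; punchInᵢ≢i; 2↔Bool; remQuot-combine; combine-remQuot
        ; finToFun-funToFin; funToFin-finToFin; splitAt-↑ˡ; splitAt-↑ʳ)
  renaming (_≟_ to _≟ᶠ_)
open import Data.Fin.Subset using (Subset)
open import Data.Fin.Subset.Properties using (anySubset?)
open import Data.List using (List; []; _∷_)
open import Data.List.Relation.Unary.All using (All; lookupAny) renaming (all? to allᴸ?)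
open import Data.List.Relation.Unary.Any as Any using (Any) renaming (any? to anyᴸ?)
import Data.List.Membership.DecPropositional as DecMembership
import Data.Nat.Properties as ℕ
open import Data.Nat using (zero; suc; _%_; _≡ᵇ_)
open import Data.Product using (∃; ∃₂; proj₁; proj₂)
import Data.Product as Product
open import Data.Product.Properties using (≡-dec)
open import Data.Sum using (_⊎_; inj₁; inj₂; [_,_]; [_,_]′)
import Data.Sum as Sum
open import Data.Vec using (Vec; []; _∷_; lookup; tabulate)
open import Data.Vec.Properties using (lookup∘tabulate)
open import Data.Vec.Functional using (updateAt)
open import Data.Vec.Functional.Properties using (updateAt-updates; updateAt-minimal)
open import Function using (_∘_; Equivalence; Inverse)
open import Level using (0ℓ)
open import Relation.Binary.Definitions using (DecidableEquality)
open import Relation.Binary.PropositionalEquality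
  using (_≢_; refl; sym; trans; cong; cong₂; _≗_; module ≡-Reasoning)
open import Relation.Nullary using (Dec; yes; no; ¬?; contradiction)
open import Relation.Nullary.Decidable
  using (⌊_⌋; map′; from-yes; toWitness; decidable-stable; _×-dec_; _⊎-dec_; _→-dec_)
open import Relation.Unary using (Pred; Decidable)

open CommutativeRing Bool.xor-∧-commutativeRing
  using (+-commutativeMonoid; +-commutativeSemigroup)
open import Algebra.Properties.CommutativeMonoid.Sum +-commutativeMonoid
  using (sum; sum-cong-≗; sum-remove; sum-replicate-zero; ∑-distrib-+)
open Inverse 2↔Bool using (to; from; strictlyInverseˡ; strictlyInverseʳ)

∀²? : ∀ {a b} {P : Pred (Fin a × Fin b) 0ℓ} → Decidable P → Dec (∀ u → P u)
∀²? P? = map′ (λ h (i , j) → h i j) (λ h i j → h (i , j)) (all? λ i → all? λ j → P? (i , j))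

∃²? : ∀ {a b} {P : Pred (Fin a × Fin b) 0ℓ} → Decidable P → Dec (∃ P)
∃²? P? = map′ (λ (i , j , p) → (i , j) , p) (λ ((i , j) , p) → i , j , p)
  (any? λ i → any? λ j → P? (i , j))

∃ᴮ? : {P : Pred Bool 0ℓ} → Decidable P → Dec (∃ P)
∃ᴮ? P? = map′ [ (false ,_) , (true ,_) ] (λ { (false , p) → inj₁ p ; (true , p) → inj₂ p })
  (P? false ⊎-dec P? true)

-- Subsets as tables: they can be enumerated, and a computed one is evaluated only
-- once and then shared by all lookups.
Grid : ℕ → ℕ → Set
Grid a b = Vec (Subset b) a

toPred : ∀ {a b} → Grid a b → Fin a × Fin b → Bool
toPred g (i , j) = lookup (lookup g i) j

fromPred : ∀ {a b} → (Fin a × Fin b → Bool) → Grid a b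
fromPred A = tabulate λ i → tabulate λ j → A (i , j)

toPred-fromPred : ∀ {a b} (A : Fin a × Fin b → Bool) → toPred (fromPred A) ≗ A
toPred-fromPred A (i , j) rewrite lookup∘tabulate (λ i → tabulate λ j → A (i , j)) i =
  lookup∘tabulate (λ j → A (i , j)) j

∃-grid? : ∀ a {b} {P : Pred (Grid a b) 0ℓ} → Decidable P → Dec (∃ P)
∃-grid? zero    P? = map′ ([] ,_) (λ { ([] , p) → p }) (P? [])
∃-grid? (suc a) P? = map′ (λ (r , g , p) → r ∷ g , p) (λ { (r ∷ g , p) → r , g , p })
  (anySubset? λ r → ∃-grid? a λ g → P? (r ∷ g))

∀-grid? : ∀ a {b} {P : Pred (Grid a b) 0ℓ} → Decidable P → Dec (∀ g → P g)
∀-grid? a P? = map′ (λ ∄ g → decidable-stable (P? g) (λ ¬p → ∄ (g , ¬p)))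
  (λ ∀p (g , ¬p) → ¬p (∀p g)) (¬? (∃-grid? a λ g → ¬? (P? g)))

exhaustive : ∀ {a b} (P : Pred (Fin a × Fin b → Bool) 0ℓ) →
  (∀ {A B} → A ≗ B → P A → P B) → (∀ g → P (toPred g)) → ∀ A → P A
exhaustive P resp all A = resp (toPred-fromPred A) (all (fromPred A))

sumFin-cong : ∀ k {f g : Fin k → ℕ} → f ≗ g → sumFin k f ≡ sumFin k g
sumFin-cong zero    f≗g = refl
sumFin-cong (suc k) f≗g = cong₂ _+_ (f≗g zero) (sumFin-cong k (f≗g ∘ suc))

card4-cong : ∀ {A B} → A ≗ B → card4 A ≡ card4 B
card4-cong A≗B = sumFin-cong 4 λ i → sumFin-cong 4 λ j → cong b2n (A≗B (i , j))

card2-cong : ∀ {A B} → A ≗ B → card2 A ≡ card2 B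
card2-cong A≗B = sumFin-cong 2 λ i → sumFin-cong 2 λ j → cong b2n (A≗B (i , j))

-- Cosets of the kernels of the homomorphisms onto ℤ₂

odd : ∀ {k} → Fin k → Bool
odd i = toℕ i % 2 ≡ᵇ 1

-- For even a and b, the three nonzero homomorphisms ℤ_a × ℤ_b → ℤ₂.
parity : ∀ {a b} → Fin 3 → Fin a × Fin b → Bool
parity 0F (x , y) = odd x
parity 1F (x , y) = odd y
parity 2F (x , y) = odd x xor odd y

Affine : ∀ {a b} → (Fin a × Fin b → Bool) → Set
Affine A = ∃₂ λ c s → ∀ u → A u ≡ parity c u xor s

affine? : ∀ {a b} (A : Fin a × Fin b → Bool) → Dec (Affine A)
affine? A = any? λ c → ∃ᴮ? λ s → ∀²? λ u → A u Bool.≟ parity c u xor s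

Affine-resp-≗ : ∀ {a b} {A B : Fin a × Fin b → Bool} → A ≗ B → Affine A → Affine B
Affine-resp-≗ A≗B (c , s , e) = c , s , λ u → trans (sym (A≗B u)) (e u)

parity-origin : ∀ {a b} c → parity {suc a} {suc b} c (zero , zero) ≡ false
parity-origin 0F = refl
parity-origin 1F = refl
parity-origin 2F = refl

parity-injective : ∀ {a b} {c c′} →
  (∀ (u : Fin (suc (suc a)) × Fin (suc (suc b))) → parity c u ≡ parity c′ u) → c ≡ c′
parity-injective {c = 0F} {0F} eq = refl
parity-injective {c = 0F} {1F} eq = contradiction (eq (1F , 0F)) λ ()
parity-injective {c = 0F} {2F} eq = contradiction (eq (0F , 1F)) λ ()
parity-injective {c = 1F} {0F} eq = contradiction (eq (1F , 0F)) λ ()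
parity-injective {c = 1F} {1F} eq = refl
parity-injective {c = 1F} {2F} eq = contradiction (eq (1F , 0F)) λ ()
parity-injective {c = 2F} {0F} eq = contradiction (eq (0F , 1F)) λ ()
parity-injective {c = 2F} {1F} eq = contradiction (eq (1F , 0F)) λ ()
parity-injective {c = 2F} {2F} eq = refl

parity-card2 : ∀ d → card2 (parity d) ≡ 2
parity-card2 0F = refl
parity-card2 1F = refl
parity-card2 2F = refl

opaque
  card2≡2⇒affine : ∀ B → card2 B ≡ 2 → Affine B
  card2≡2⇒affine = exhaustive (λ B → card2 B ≡ 2 → Affine B)
    (λ A≗B h c → Affine-resp-≗ A≗B (h (trans (card2-cong A≗B) c)))
    (from-yes (∀-grid? 2 λ g → (card2 (toPred g) ℕ.≟ 2) →-dec affine? (toPred g)))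

-- Independent sets of the Shrikhande graph

_≟ᵥ_ : DecidableEquality Z4²
_≟ᵥ_ = ≡-dec _≟ᶠ_ _≟ᶠ_

shConn? : Decidable ShConn
shConn? (0F , 0F) = no λ ()
shConn? (0F , 1F) = yes c01
shConn? (0F , 2F) = no λ ()
shConn? (0F , 3F) = yes c03
shConn? (1F , 0F) = yes c10
shConn? (1F , 1F) = yes c11
shConn? (1F , 2F) = no λ ()
shConn? (1F , 3F) = no λ ()
shConn? (2F , _)  = no λ ()
shConn? (3F , 0F) = yes c30
shConn? (3F , 1F) = no λ ()
shConn? (3F , 2F) = no λ ()
shConn? (3F , 3F) = yes c33

shAdj? : ∀ u v → Dec (ShAdj u v)
shAdj? u v = shConn? (sub u v)

independent? : ∀ I → Dec (Independent I)
independent? I = ∀²? λ u → ∀²? λ v →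
  (I u Bool.≟ true) →-dec (I v Bool.≟ true) →-dec ¬? (shAdj? u v)

Independent-resp-≗ : ∀ {I J} → I ≗ J → Independent I → Independent J
Independent-resp-≗ I≗J indI u v Ju Jv = indI u v (trans (I≗J u) Ju) (trans (I≗J v) Jv)

open DecMembership _≟ᵥ_ using (_∈?_)

⟦_⟧ : List Z4² → Subset4
⟦ vs ⟧ u = ⌊ u ∈? vs ⌋

independent4Sets : List (List Z4²)
independent4Sets =
  ((0F , 0F) ∷ (0F , 2F) ∷ (2F , 0F) ∷ (2F , 2F) ∷ []) ∷
  ((0F , 0F) ∷ (0F , 2F) ∷ (2F , 1F) ∷ (2F , 3F) ∷ []) ∷
  ((0F , 0F) ∷ (1F , 2F) ∷ (2F , 0F) ∷ (3F , 2F) ∷ []) ∷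
  ((0F , 0F) ∷ (1F , 3F) ∷ (2F , 2F) ∷ (3F , 1F) ∷ []) ∷
  ((0F , 1F) ∷ (0F , 3F) ∷ (2F , 0F) ∷ (2F , 2F) ∷ []) ∷
  ((0F , 1F) ∷ (0F , 3F) ∷ (2F , 1F) ∷ (2F , 3F) ∷ []) ∷
  ((0F , 1F) ∷ (1F , 0F) ∷ (2F , 3F) ∷ (3F , 2F) ∷ []) ∷
  ((0F , 1F) ∷ (1F , 3F) ∷ (2F , 1F) ∷ (3F , 3F) ∷ []) ∷
  ((0F , 2F) ∷ (1F , 0F) ∷ (2F , 2F) ∷ (3F , 0F) ∷ []) ∷
  ((0F , 2F) ∷ (1F , 1F) ∷ (2F , 0F) ∷ (3F , 3F) ∷ []) ∷
  ((0F , 3F) ∷ (1F , 1F) ∷ (2F , 3F) ∷ (3F , 1F) ∷ []) ∷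
  ((0F , 3F) ∷ (1F , 2F) ∷ (2F , 1F) ∷ (3F , 0F) ∷ []) ∷
  ((1F , 0F) ∷ (1F , 2F) ∷ (3F , 0F) ∷ (3F , 2F) ∷ []) ∷
  ((1F , 0F) ∷ (1F , 2F) ∷ (3F , 1F) ∷ (3F , 3F) ∷ []) ∷
  ((1F , 1F) ∷ (1F , 3F) ∷ (3F , 0F) ∷ (3F , 2F) ∷ []) ∷
  ((1F , 1F) ∷ (1F , 3F) ∷ (3F , 1F) ∷ (3F , 3F) ∷ []) ∷ []

InIndependent4Sets : Subset4 → Set
InIndependent4Sets I = Any (λ vs → I ≗ ⟦ vs ⟧) independent4Sets

opaque
  independent4-classification : ∀ I → card4 I ≡ 4 → Independent I → InIndependent4Sets I
  independent4-classification = exhaustive P P-resp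
    (from-yes (∀-grid? 4 λ g → (card4 (toPred g) ℕ.≟ 4) →-dec independent? (toPred g) →-dec
       anyᴸ? (λ vs → ∀²? λ u → toPred g u Bool.≟ ⟦ vs ⟧ u) independent4Sets))
    where
    P : Subset4 → Set
    P I = card4 I ≡ 4 → Independent I → InIndependent4Sets I
    P-resp : ∀ {A B} → A ≗ B → P A → P B
    P-resp A≗B h |B| indB = Any.map (λ e u → trans (sym (A≗B u)) (e u))
      (h (trans (card4-cong A≗B) |B|) (Independent-resp-≗ (sym ∘ A≗B) indB))

Reach-snoc : ∀ {A u v w} → Reach A u v → A w ≡ true → ShAdj v w → Reach A u w
Reach-snoc here            Aw v~w = step Aw v~w here
Reach-snoc (step Av u~v r) Aw v~w = step Av u~v (Reach-snoc r Aw v~w)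

Reach-resp-≗ : ∀ {A B u v} → A ≗ B → Reach A u v → Reach B u v
Reach-resp-≗ A≗B here            = here
Reach-resp-≗ A≗B (step Av u~v r) = step (trans (sym (A≗B _)) Av) u~v (Reach-resp-≗ A≗B r)

Closed : Subset4 → Subset4 → Set
Closed A S = ∀ v w → S v ≡ true → A w ≡ true → ShAdj v w → S w ≡ true

closed? : ∀ A S → Dec (Closed A S)
closed? A S = ∀²? λ v → ∀²? λ w →
  (S v Bool.≟ true) →-dec (A w Bool.≟ true) →-dec shAdj? v w →-dec (S w Bool.≟ true)

Reach-closed : ∀ {A S u v} → Closed A S → S u ≡ true → Reach A u v → S v ≡ true
Reach-closed closed Su here            = Su
Reach-closed closed Su (step Av u~v r) = Reach-closed closed (closed _ _ Su Av u~v) r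

separated⇒disconnected : ∀ {A S} u v → A u ≡ true → A v ≡ true →
  Closed A S → S u ≡ true → S v ≡ false → Disconnected A
separated⇒disconnected u v Au Av closed Su Sv = u , v , Au , Av , λ u⇝v →
  Bool.not-¬ (Reach-closed closed Su u⇝v) Sv

Connected : Subset4 → Set
Connected A = ∀ u v → A u ≡ true → A v ≡ true → Reach A u v

Connected-resp-≗ : ∀ {A B} → A ≗ B → Connected A → Connected B
Connected-resp-≗ A≗B conn u v Bu Bv =
  Reach-resp-≗ A≗B (conn u v (trans (A≗B u) Bu) (trans (A≗B v) Bv))

adjacentTo? : ∀ (R : Subset4) w → Dec (∃ λ v → R v ≡ true × ShAdj v w)
adjacentTo? R w = ∃²? λ v → (R v Bool.≟ true) ×-dec shAdj? v w

expand : Subset4 → Subset4 → Subset4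
expand A R w = R w ∨ (A w ∧ ⌊ adjacentTo? R w ⌋)

expand-sound : ∀ A R w → expand A R w ≡ true →
  R w ≡ true ⊎ (A w ≡ true × ∃ λ v → R v ≡ true × ShAdj v w)
expand-sound A R w h with Equivalence.to (Bool.T-∨ {R w}) (Equivalence.from Bool.T-≡ h)
... | inj₁ Rw = inj₁ (Equivalence.to Bool.T-≡ Rw)
... | inj₂ Aw∧adj with Equivalence.to (Bool.T-∧ {A w}) Aw∧adj
...   | Aw , adj = inj₂ (Equivalence.to Bool.T-≡ Aw , toWitness adj)

-- Opaque, so that the type checker never unfolds a search symbolically.
opaque
  ball : Subset4 → Z4² → ℕ → Grid 4 4
  ball A u zero    = fromPred λ v → ⌊ v ≟ᵥ u ⌋
  ball A u (suc k) = fromPred (expand A (toPred (ball A u k)))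

  ball-sound : ∀ A u k v → toPred (ball A u k) v ≡ true → Reach A u v
  ball-sound A u zero v h
    with toWitness {a? = v ≟ᵥ u} (Equivalence.from Bool.T-≡
           (trans (sym (toPred-fromPred (λ v → ⌊ v ≟ᵥ u ⌋) v)) h))
  ... | refl = here
  ball-sound A u (suc k) v h
    with expand-sound A (toPred (ball A u k)) v
           (trans (sym (toPred-fromPred (expand A (toPred (ball A u k))) v)) h)
  ... | inj₁ Rv                  = ball-sound A u k v Rv
  ... | inj₂ (Av , w , Rw , w~v) = Reach-snoc (ball-sound A u k w Rw) Av w~v

_⊆_ : Subset4 → Subset4 → Set
A ⊆ B = ∀ v → A v ≡ true → B v ≡ true

_⊆?_ : ∀ A B → Dec (A ⊆ B)
A ⊆? B = ∀²? λ v → (A v Bool.≟ true) →-dec (B v Bool.≟ true)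

-- Depth 7 suffices for the 8-vertex sets searched below.
BallsCover : Subset4 → Set
BallsCover A = ∀ u → A u ≡ true → A ⊆ toPred (ball A u 7)

ballsCover? : ∀ A → Dec (BallsCover A)
ballsCover? A = ∀²? λ u → (A u Bool.≟ true) →-dec (A ⊆? toPred (ball A u 7))

ballsCover⇒connected : ∀ A → BallsCover A → Connected A
ballsCover⇒connected A cover u v Au Av = ball-sound A u 7 v (cover u Au v Av)

-- Disconnected 2×MDS codes of Sh

_∪_ _∩_ _∖_ : Subset4 → Subset4 → Subset4
(A ∪ B) u = A u ∨ B u
(A ∩ B) u = A u ∧ B u
(A ∖ B) u = A u ∧ not (B u)

DisjointUnionCases : List Z4² → List Z4² → Set
DisjointUnionCases vs ws =
  (∀ u → ⟦ vs ⟧ u ∧ ⟦ ws ⟧ u ≡ false) → Affine (⟦ vs ⟧ ∪ ⟦ ws ⟧) ⊎ BallsCover (⟦ vs ⟧ ∪ ⟦ ws ⟧)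

opaque
  unfolding ball

  independent4-unions : All (λ vs → All (DisjointUnionCases vs) independent4Sets) independent4Sets
  independent4-unions = from-yes (allᴸ? (λ vs → allᴸ? (cases? vs) independent4Sets) independent4Sets)
    where
    cases? : ∀ vs ws → Dec (DisjointUnionCases vs ws)
    cases? vs ws = (∀²? λ u → (⟦ vs ⟧ u ∧ ⟦ ws ⟧ u) Bool.≟ false) →-dec
      (affine? (⟦ vs ⟧ ∪ ⟦ ws ⟧) ⊎-dec ballsCover? (⟦ vs ⟧ ∪ ⟦ ws ⟧))

union-of-independent4 : ∀ I J → InIndependent4Sets I → InIndependent4Sets J →
  (∀ u → I u ∧ J u ≡ false) → Affine (I ∪ J) ⊎ Connected (I ∪ J)
union-of-independent4 I J inI inJ I∩J≡∅ =
  Sum.map (Affine-resp-≗ (sym ∘ I∪J≗))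
    (Connected-resp-≗ (sym ∘ I∪J≗) ∘ ballsCover⇒connected (⟦ vs ⟧ ∪ ⟦ ws ⟧))
    (cases λ u → trans (sym (cong₂ _∧_ (I≗ u) (J≗ u))) (I∩J≡∅ u))
  where
  vs ws : List Z4²
  vs = Any.lookup inI
  ws = Any.lookup inJ
  row : All (DisjointUnionCases vs) independent4Sets × I ≗ ⟦ vs ⟧
  row = lookupAny independent4-unions inI
  I≗ : I ≗ ⟦ vs ⟧
  I≗ = proj₂ row
  cases : DisjointUnionCases vs ws
  cases = proj₁ (lookupAny (proj₁ row) inJ)
  J≗ : J ≗ ⟦ ws ⟧
  J≗ = proj₂ (lookupAny (proj₁ row) inJ)
  I∪J≗ : I ∪ J ≗ ⟦ vs ⟧ ∪ ⟦ ws ⟧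
  I∪J≗ u = cong₂ _∨_ (I≗ u) (J≗ u)

disconnected2MDS⇒affine : ∀ A → Is2MDS A → Disconnected A → Affine A
disconnected2MDS⇒affine A (_ , I , J , indI , indJ , |I| , |J| , I∩J≡∅ , A≗I∪J)
                          (u , v , Au , Av , u↛v) =
  [ Affine-resp-≗ I∪J≗A
  , (λ conn → ⊥-elim (u↛v (Connected-resp-≗ I∪J≗A conn u v Au Av))) ]
  (union-of-independent4 I J (independent4-classification I |I| indI)
    (independent4-classification J |J| indJ) I∩J≡∅)
  where
  I∪J≗A : I ∪ J ≗ A
  I∪J≗A w = sym (A≗I∪J w)

splits-into-independent : ∀ A B → card4 A ≡ 8 → card4 (A ∩ B) ≡ 4 → card4 (A ∖ B) ≡ 4 →
  Independent (A ∩ B) → Independent (A ∖ B) → Is2MDS A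
splits-into-independent A B |A| |A∩B| |A∖B| indA∩B indA∖B =
  |A| , A ∩ B , A ∖ B , indA∩B , indA∖B , |A∩B| , |A∖B| ,
  (λ u → disjoint (A u) (B u)) , (λ u → cover (A u) (B u))
  where
  disjoint : ∀ a b → (a ∧ b) ∧ (a ∧ not b) ≡ false
  disjoint false _ = refl
  disjoint true  b = Bool.∧-inverseʳ b
  cover : ∀ a b → a ≡ (a ∧ b) ∨ (a ∧ not b)
  cover false _ = refl
  cover true  b = sym (Bool.∨-inverseʳ b)

parity-2MDS : ∀ c → Is2MDS (parity c)
parity-2MDS 0F = splits-into-independent (parity 0F) (parity 1F) refl refl refl
  (from-yes (independent? (parity 0F ∩ parity 1F)))
  (from-yes (independent? (parity 0F ∖ parity 1F)))
parity-2MDS 1F = splits-into-independent (parity 1F) (parity 2F) refl refl refl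
  (from-yes (independent? (parity 1F ∩ parity 2F)))
  (from-yes (independent? (parity 1F ∖ parity 2F)))
parity-2MDS 2F = splits-into-independent (parity 2F) (parity 0F) refl refl refl
  (from-yes (independent? (parity 2F ∩ parity 0F)))
  (from-yes (independent? (parity 2F ∖ parity 0F)))

opaque
  unfolding ball

  parity-disconnected : ∀ c → Disconnected (parity c)
  parity-disconnected 0F = separated⇒disconnected (1F , 0F) (3F , 0F) refl refl
    (from-yes (closed? (parity 0F) (toPred (ball (parity 0F) (1F , 0F) 7)))) refl refl
  parity-disconnected 1F = separated⇒disconnected (0F , 1F) (0F , 3F) refl refl
    (from-yes (closed? (parity 1F) (toPred (ball (parity 1F) (0F , 1F) 7)))) refl refl
  parity-disconnected 2F = separated⇒disconnected (0F , 1F) (0F , 3F) refl refl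
    (from-yes (closed? (parity 2F) (toPred (ball (parity 2F) (0F , 1F) 7)))) refl refl

xorSum≡sum : ∀ k (f : Fin k → Bool) → xorSum k f ≡ sum f
xorSum≡sum zero    f = refl
xorSum≡sum (suc k) f = cong (f zero xor_) (xorSum≡sum k (f ∘ suc))

xorSum-cong : ∀ k {f g : Fin k → Bool} → f ≗ g → xorSum k f ≡ xorSum k g
xorSum-cong k {f} {g} f≗g = begin
  xorSum k f ≡⟨ xorSum≡sum k f ⟩
  sum f      ≡⟨ sum-cong-≗ f≗g ⟩
  sum g      ≡⟨ xorSum≡sum k g ⟨
  xorSum k g ∎
  where open ≡-Reasoning

xorSum-xor : ∀ k (f g : Fin k → Bool) →
  xorSum k (λ i → f i xor g i) ≡ xorSum k f xor xorSum k g
xorSum-xor k f g = begin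
  xorSum k (λ i → f i xor g i) ≡⟨ xorSum≡sum k _ ⟩
  sum (λ i → f i xor g i)      ≡⟨ ∑-distrib-+ f g ⟩
  sum f xor sum g              ≡⟨ cong₂ _xor_ (xorSum≡sum k f) (xorSum≡sum k g) ⟨
  xorSum k f xor xorSum k g    ∎
  where open ≡-Reasoning

xorSum-false : ∀ k {f : Fin k → Bool} → (∀ i → f i ≡ false) → xorSum k f ≡ false
xorSum-false k {f} f≡false = begin
  xorSum k f             ≡⟨ xorSum-cong k f≡false ⟩
  xorSum k (λ _ → false) ≡⟨ xorSum≡sum k _ ⟩
  sum {k} (λ _ → false)  ≡⟨ sum-replicate-zero k ⟩
  false                  ∎
  where open ≡-Reasoning

xorSum-single : ∀ {k} (f : Fin k → Bool) i → (∀ j → j ≢ i → f j ≡ false) → xorSum k f ≡ f i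
xorSum-single {suc k} f i f≡false = begin
  xorSum (suc k) f                         ≡⟨ xorSum≡sum (suc k) f ⟩
  sum f                                    ≡⟨ sum-remove f ⟩
  f i xor sum (f ∘ punchIn i)              ≡⟨ cong (f i xor_) (xorSum≡sum k _) ⟨
  f i xor xorSum k (f ∘ punchIn i)
    ≡⟨ cong (f i xor_) (xorSum-false k λ j → f≡false _ (punchInᵢ≢i i j)) ⟩
  f i xor false                            ≡⟨ Bool.xor-identityʳ (f i) ⟩
  f i                                      ∎
  where open ≡-Reasoning

xorSum-affine : ∀ k {f g s : Fin k → Bool} → (∀ i → f i ≡ g i xor s i) →
  xorSum k f ≡ xorSum k g xor xorSum k s
xorSum-affine k {g = g} {s} f≗g⊕s = trans (xorSum-cong k f≗g⊕s) (xorSum-xor k g s)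

xor-cancelʳ : ∀ s {a b} → a xor s ≡ b xor s → a ≡ b
xor-cancelʳ s {a} {b} eq = begin
  a                ≡⟨ xor-xor a ⟨
  (a xor s) xor s  ≡⟨ cong (_xor s) eq ⟩
  (b xor s) xor s  ≡⟨ xor-xor b ⟩
  b                ∎
  where
  open ≡-Reasoning
  xor-xor : ∀ x → (x xor s) xor s ≡ x
  xor-xor x = trans (Bool.xor-assoc x s s)
    (trans (cong (x xor_) (Bool.xor-same s)) (Bool.xor-identityʳ x))

xor-regroup : ∀ a b c d e → ((a xor b) xor (c xor d)) xor e ≡ (a xor c) xor ((b xor d) xor e)
xor-regroup a b c d e = trans (cong (_xor e) (interchange +-commutativeSemigroup a b c d))
  (Bool.xor-assoc (a xor c) (b xor d) e)

-- The linear codes, parametrised by σ and one homomorphism per coordinate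

paritySum : ∀ {k a b} → (Fin k → Fin 3) → (Fin k → Fin a × Fin b) → Bool
paritySum {k} c x = xorSum k (λ i → parity (c i) (x i))

origin : ∀ {k a b} → Fin k → Fin (suc a) × Fin (suc b)
origin _ = zero , zero

δ : ∀ {k a b} → Fin k → Fin (suc a) × Fin (suc b) → Fin k → Fin (suc a) × Fin (suc b)
δ i p = updateAt origin i (λ _ → p)

paritySum-origin : ∀ {k a b} (c : Fin k → Fin 3) → paritySum {a = suc a} {suc b} c origin ≡ false
paritySum-origin {k} c = xorSum-false k λ i → parity-origin (c i)

paritySum-δ : ∀ {k a b} (c : Fin k → Fin 3) i (p : Fin (suc a) × Fin (suc b)) →
  paritySum c (δ i p) ≡ parity (c i) p
paritySum-δ c i p = trans
  (xorSum-single _ i λ j j≢i →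
    trans (cong (parity (c j)) (updateAt-minimal j i origin j≢i)) (parity-origin (c j)))
  (cong (parity (c i)) (updateAt-updates i origin))

code : ∀ {m n} → Bool → (Fin m → Fin 3) → (Fin n → Fin 3) → Code m n
code σ c d (x , y) = (paritySum c x xor paritySum d y) xor σ

code-cong : ∀ {m n σ σ′} {c c′ : Fin m → Fin 3} {d d′ : Fin n → Fin 3} →
  σ ≡ σ′ → c ≗ c′ → d ≗ d′ → code σ c d ≐ code σ′ c′ d′
code-cong {m} {n} {σ} refl c≗c′ d≗d′ (x , y) = cong (_xor σ) (cong₂ _xor_
  (xorSum-cong m λ i → cong (λ c → parity c (x i)) (c≗c′ i))
  (xorSum-cong n λ j → cong (λ d → parity d (y j)) (d≗d′ j)))

code-at-origin : ∀ {m n} σ (c : Fin m → Fin 3) (d : Fin n → Fin 3) →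
  code σ c d (origin , origin) ≡ σ
code-at-origin σ c d = cong (_xor σ) (cong₂ _xor_ (paritySum-origin c) (paritySum-origin d))

code-at-δˣ : ∀ {m n} σ (c : Fin m → Fin 3) (d : Fin n → Fin 3) i p →
  code σ c d (δ i p , origin) ≡ parity (c i) p xor σ
code-at-δˣ σ c d i p = cong (_xor σ) (trans
  (cong₂ _xor_ (paritySum-δ c i p) (paritySum-origin d)) (Bool.xor-identityʳ (parity (c i) p)))

code-at-δʸ : ∀ {m n} σ (c : Fin m → Fin 3) (d : Fin n → Fin 3) j q →
  code σ c d (origin , δ j q) ≡ parity (d j) q xor σ
code-at-δʸ σ c d j q = cong (_xor σ) (cong₂ _xor_ (paritySum-origin c) (paritySum-δ d j q))

code-injective : ∀ {m n σ σ′} {c c′ : Fin m → Fin 3} {d d′ : Fin n → Fin 3} →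
  code σ c d ≐ code σ′ c′ d′ → σ ≡ σ′ × c ≗ c′ × d ≗ d′
code-injective {σ = σ} {σ′} {c} {c′} {d} {d′} eq = σ≡σ′ , c≗c′ , d≗d′
  where
  open ≡-Reasoning
  σ≡σ′ : σ ≡ σ′
  σ≡σ′ = trans (sym (code-at-origin σ c d)) (trans (eq _) (code-at-origin σ′ c′ d′))
  c≗c′ : c ≗ c′
  c≗c′ i = parity-injective λ p → xor-cancelʳ σ (begin
    parity (c i) p xor σ      ≡⟨ code-at-δˣ σ c d i p ⟨
    code σ c d (δ i p , _)    ≡⟨ eq _ ⟩
    code σ′ c′ d′ (δ i p , _) ≡⟨ code-at-δˣ σ′ c′ d′ i p ⟩
    parity (c′ i) p xor σ′    ≡⟨ cong (parity (c′ i) p xor_) σ≡σ′ ⟨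
    parity (c′ i) p xor σ     ∎)
  d≗d′ : d ≗ d′
  d≗d′ j = parity-injective λ q → xor-cancelʳ σ (begin
    parity (d j) q xor σ      ≡⟨ code-at-δʸ σ c d j q ⟨
    code σ c d (_ , δ j q)    ≡⟨ eq _ ⟩
    code σ′ c′ d′ (_ , δ j q) ≡⟨ code-at-δʸ σ′ c′ d′ j q ⟩
    parity (d′ j) q xor σ′    ≡⟨ cong (parity (d′ j) q xor_) σ≡σ′ ⟨
    parity (d′ j) q xor σ     ∎)

code-linear : ∀ {m n} σ (c : Fin m → Fin 3) (d : Fin n → Fin 3) → Linear m n (code σ c d)
code-linear σ c d = (λ i → parity (c i)) , (λ j → parity (d j)) , σ ,
  (λ i → parity-2MDS (c i) , parity-disconnected (c i)) , (λ j → parity-card2 (d j)) , λ x y → refl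

linear⇒code : ∀ {m n} M → Linear m n M → ∃ λ σ → ∃₂ λ c d → M ≐ code {m} {n} σ c d
linear⇒code {m} {n} M (A , B , σ , A-good , B-card , M≡) =
  (xorSum m s xor xorSum n t) xor σ , c , d , λ (x , y) → begin
    M (x , y)
      ≡⟨ M≡ x y ⟩
    (xorSum m (λ i → A i (x i)) xor xorSum n (λ j → B j (y j))) xor σ
      ≡⟨ cong (_xor σ) (cong₂ _xor_ (xorSum-affine m λ i → A≗ i (x i))
                                     (xorSum-affine n λ j → B≗ j (y j))) ⟩
    ((paritySum c x xor xorSum m s) xor (paritySum d y xor xorSum n t)) xor σ
      ≡⟨ xor-regroup (paritySum c x) (xorSum m s) (paritySum d y) (xorSum n t) σ ⟩
    (paritySum c x xor paritySum d y) xor ((xorSum m s xor xorSum n t) xor σ)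
      ∎
  where
  open ≡-Reasoning
  A-affine : ∀ i → Affine (A i)
  A-affine i = disconnected2MDS⇒affine (A i) (proj₁ (A-good i)) (proj₂ (A-good i))
  B-affine : ∀ j → Affine (B j)
  B-affine j = card2≡2⇒affine (B j) (B-card j)
  c : Fin m → Fin 3
  c i = proj₁ (A-affine i)
  s : Fin m → Bool
  s i = proj₁ (proj₂ (A-affine i))
  A≗ : ∀ i u → A i u ≡ parity (c i) u xor s i
  A≗ i = proj₂ (proj₂ (A-affine i))
  d : Fin n → Fin 3
  d j = proj₁ (B-affine j)
  t : Fin n → Bool
  t j = proj₁ (proj₂ (B-affine j))
  B≗ : ∀ j u → B j u ≡ parity (d j) u xor t j
  B≗ j = proj₂ (proj₂ (B-affine j))

Parameters : ℕ → Set
Parameters k = Bool × (Fin k → Fin 3)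

funToFin-cong : ∀ {m n} {f g : Fin m → Fin n} → f ≗ g → funToFin f ≡ funToFin g
funToFin-cong {zero}  f≗g = refl
funToFin-cong {suc m} f≗g = cong₂ combine (f≗g zero) (funToFin-cong (f≗g ∘ suc))

≗-split : ∀ m {n} {A : Set} {f g : Fin (m + n) → A} →
  (∀ i → f (i ↑ˡ n) ≡ g (i ↑ˡ n)) → (∀ j → f (m ↑ʳ j) ≡ g (m ↑ʳ j)) → f ≗ g
≗-split zero    left right j       = right j
≗-split (suc m) left right zero    = left zero
≗-split (suc m) left right (suc i) = ≗-split m (left ∘ suc) right i

decode : ∀ k → Fin (2 * 3 ^ k) → Parameters k
decode k i = Product.map to finToFun (remQuot {2} (3 ^ k) i)

encode : ∀ k → Parameters k → Fin (2 * 3 ^ k)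
encode k (σ , f) = combine (from σ) (funToFin f)

encode-decode : ∀ k i → encode k (decode k i) ≡ i
encode-decode k i = trans
  (cong₂ combine (strictlyInverseʳ (proj₁ (remQuot {2} (3 ^ k) i)))
                 (funToFin-finToFin {k} {3} (proj₂ (remQuot {2} (3 ^ k) i))))
  (combine-remQuot {2} (3 ^ k) i)

encode-cong : ∀ k {σ σ′ f f′} → σ ≡ σ′ → f ≗ f′ → encode k (σ , f) ≡ encode k (σ′ , f′)
encode-cong k {σ} refl f≗f′ = cong (combine {2} (from σ)) (funToFin-cong f≗f′)

decode-encode : ∀ k σ f → decode k (encode k (σ , f)) ≡ (to (from σ) , finToFun (funToFin f))
decode-encode k σ f = cong (Product.map to finToFun) (remQuot-combine (from σ) (funToFin f))

codeOf : ∀ m n → Parameters (m + n) → Code m n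
codeOf m n (σ , f) = code σ (λ i → f (i ↑ˡ n)) (λ j → f (m ↑ʳ j))

codeOf-linear : ∀ m n p → Linear m n (codeOf m n p)
codeOf-linear m n (σ , f) = code-linear σ (λ i → f (i ↑ˡ n)) (λ j → f (m ↑ʳ j))

codeOf-injective : ∀ m n p q → codeOf m n p ≐ codeOf m n q → proj₁ p ≡ proj₁ q × proj₂ p ≗ proj₂ q
codeOf-injective m n p q eq with code-injective eq
... | σ≡σ′ , left , right = σ≡σ′ , ≗-split m left right

codeOf-join : ∀ {m n} σ (c : Fin m → Fin 3) (d : Fin n → Fin 3) →
  codeOf m n (σ , [ c , d ]′ ∘ splitAt m) ≐ code σ c d
codeOf-join {m} {n} σ c d = code-cong refl
  (λ i → cong [ c , d ]′ (splitAt-↑ˡ m i n)) (λ j → cong [ c , d ]′ (splitAt-↑ʳ m n j))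

codeAt : ∀ m n → Fin (2 * 3 ^ (m + n)) → Code m n
codeAt m n k = codeOf m n (decode (m + n) k)

codeAt-injective : ∀ m n {k l} → codeAt m n k ≐ codeAt m n l → k ≡ l
codeAt-injective m n {k} {l} eq = begin
  k                                 ≡⟨ encode-decode (m + n) k ⟨
  encode (m + n) (decode (m + n) k) ≡⟨ encode-cong (m + n) (proj₁ same) (proj₂ same) ⟩
  encode (m + n) (decode (m + n) l) ≡⟨ encode-decode (m + n) l ⟩
  l                                 ∎
  where
  open ≡-Reasoning
  same : proj₁ (decode (m + n) k) ≡ proj₁ (decode (m + n) l) ×
         proj₂ (decode (m + n) k) ≗ proj₂ (decode (m + n) l)
  same = codeOf-injective m n (decode (m + n) k) (decode (m + n) l) eq

codeAt-encode : ∀ m n σ f → codeAt m n (encode (m + n) (σ , f)) ≐ codeOf m n (σ , f)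
codeAt-encode m n σ f v = trans (cong (λ p → codeOf m n p v) (decode-encode (m + n) σ f))
  (code-cong (strictlyInverseˡ σ) (λ i → finToFun-funToFin f (i ↑ˡ n))
    (λ j → finToFun-funToFin f (m ↑ʳ j)) v)

codeAt-surjective : ∀ m n M → Linear m n M → Σ (Fin (2 * 3 ^ (m + n))) λ k → M ≐ codeAt m n k
codeAt-surjective m n M linear =
  encode (m + n) (σ , f) , λ v →
    trans (M≐code v) (sym (trans (codeAt-encode m n σ f v) (codeOf-join σ c d v)))
  where
  σ : Bool
  σ = proj₁ (linear⇒code M linear)
  c : Fin m → Fin 3
  c = proj₁ (proj₂ (linear⇒code M linear))
  d : Fin n → Fin 3
  d = proj₁ (proj₂ (proj₂ (linear⇒code M linear)))
  M≐code : M ≐ code σ c d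
  M≐code = proj₂ (proj₂ (proj₂ (linear⇒code M linear)))
  f : Fin (m + n) → Fin 3
  f = [ c , d ]′ ∘ splitAt m

lemma5 : ∀ m n →
    Σ (Fin (2 * 3 ^ (m + n)) → Code m n) λ e →
      (∀ k → Linear m n (e k)) ×
      (∀ k l → e k ≐ e l → k ≡ l) ×
      (∀ M → Linear m n M → Σ (Fin (2 * 3 ^ (m + n))) λ k → M ≐ e k)
lemma5 m n =
  codeAt m n ,
  (λ k → codeOf-linear m n (decode (m + n) k)) ,
  (λ k l → codeAt-injective m n {k} {l}) ,
  codeAt-surjective m n
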